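{- For all $k\in\mathbb{N}$ we have $|\mathcal{M}_k|\le|\mathcal{M}_{k+1}|$, where $\mathcal{M}_k$ denotes the set of all $k$-uniform MLCIFs on $[2k]$.
   Context: For $G=\{y_1<\dots<y_k\}$, $F=\{x_1<\dots<x_k\}$ in $\binom{[n]}{k}$, write $G\leq_{\mathrm{LC}} F$ if $y_i\le x_i$ for all $i$. A $k$-uniform MLCIF on $[n]$ is a family $\mathcal{F}\subseteq\binom{[n]}{k}$ that is intersecting, closed under $\leq_{\mathrm{LC}}$-smaller sets (i.e. left-compressed), and maximal under inclusion among left-compressed intersecting families. -}

module Defs where

open import Data.Bool using (Bool; true; false)
import Data.Bool.Properties as BoolP
open import Data.Nat using (ℕ; zero; suc; _≤_; _≟_)
import Data.Nat.Properties as ℕP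
open import Data.List using (List; []; _∷_; map; _++_; filter; length)
open import Data.List.Relation.Unary.All using (All; all?)
open import Data.List.Relation.Binary.Pointwise using (Pointwise)
import Data.List.Relation.Binary.Pointwise.Properties as PwP
open import Data.Vec using ([]; _∷_)
import Data.Vec.Properties as VecP
open import Data.Fin.Subset using (Subset; inside; outside; _∩_; Nonempty; ∣_∣)
open import Data.Fin.Subset.Properties using (nonempty?)
open import Data.Product using (_×_)
open import Relation.Nullary using (Dec)
open import Relation.Nullary.Decidable using (_×-dec_; _→-dec_)
open import Relation.Binary.PropositionalEquality using (_≡_; decSetoid)
open import Relation.Binary using (DecidableEquality)

-- Subsets of [n] = {0,…,n-1} (0-based; order-isomorphic to {1,…,n}),
-- represented as characteristic vectors (stdlib 'Subset n').

allSubsets : (n : ℕ) → List (Subset n)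
allSubsets zero    = [] ∷ []
allSubsets (suc n) = map (outside ∷_) (allSubsets n) ++ map (inside ∷_) (allSubsets n)

ksets : (n k : ℕ) → List (Subset n)
ksets n k = filter (λ s → ∣ s ∣ ≟ k) (allSubsets n)

elems : {n : ℕ} → Subset n → List ℕ
elems []           = []
elems (true  ∷ s)  = 0 ∷ map suc (elems s)
elems (false ∷ s)  = map suc (elems s)

_≤LC_ : {n : ℕ} → Subset n → Subset n → Set
G ≤LC F = Pointwise _≤_ (elems G) (elems F)

-- Families of subsets, as lists.  The candidate k-uniform families on [n]
-- are exactly the sublists of 'ksets n k' (each subfamily exactly once).

Family : ℕ → Set
Family n = List (Subset n)

sublists : {A : Set} → List A → List (List A)
sublists []       = [] ∷ []
sublists (x ∷ xs) = sublists xs ++ map (x ∷_) (sublists xs)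

families : (n k : ℕ) → List (Family n)
families n k = sublists (ksets n k)

_≟S_ : {n : ℕ} → DecidableEquality (Subset n)
_≟S_ = VecP.≡-dec BoolP._≟_

module _ {n : ℕ} where
  open import Data.List.Membership.DecSetoid (decSetoid (_≟S_ {n})) public
    using (_∈_; _∈?_)

_⊆F_ : {n : ℕ} → Family n → Family n → Set
F ⊆F F′ = All (_∈ F′) F

Intersecting : {n : ℕ} → Family n → Set
Intersecting F = All (λ A → All (λ B → Nonempty (A ∩ B)) F) F

LeftCompressed : (n k : ℕ) → Family n → Set
LeftCompressed n k F = All (λ A → All (λ G → G ≤LC A → G ∈ F) (ksets n k)) F

LCI : (n k : ℕ) → Family n → Set
LCI n k F = Intersecting F × LeftCompressed n k F

MLCIF : (n k : ℕ) → Family n → Set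
MLCIF n k F = LCI n k F
            × All (λ F′ → LCI n k F′ → F ⊆F F′ → F′ ⊆F F) (families n k)

_≤LC?_ : {n : ℕ} → (G F : Subset n) → Dec (G ≤LC F)
G ≤LC? F = PwP.decidable ℕP._≤?_ (elems G) (elems F)

_⊆F?_ : {n : ℕ} → (F F′ : Family n) → Dec (F ⊆F F′)
F ⊆F? F′ = all? (_∈? F′) F

Intersecting? : {n : ℕ} → (F : Family n) → Dec (Intersecting F)
Intersecting? F = all? (λ A → all? (λ B → nonempty? (A ∩ B)) F) F

LeftCompressed? : (n k : ℕ) → (F : Family n) → Dec (LeftCompressed n k F)
LeftCompressed? n k F =
  all? (λ A → all? (λ G → (G ≤LC? A) →-dec (G ∈? F)) (ksets n k)) F

LCI? : (n k : ℕ) → (F : Family n) → Dec (LCI n k F)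
LCI? n k F = Intersecting? F ×-dec LeftCompressed? n k F

MLCIF? : (n k : ℕ) → (F : Family n) → Dec (MLCIF n k F)
MLCIF? n k F = LCI? n k F ×-dec
  all? (λ F′ → LCI? n k F′ →-dec (F ⊆F? F′ →-dec F′ ⊆F? F)) (families n k)

𝓜 : (n k : ℕ) → List (Family n)
𝓜 n k = filter (MLCIF? n k) (families n k)

#MLCIF : (n k : ℕ) → ℕ
#MLCIF n k = length (𝓜 n k)

-- For a k-uniform family F on [n] let ↑F be the (k+1)-uniform family on [n+2]
-- made of all sets containing both 0 and 1, together with {0} ∪ (A+2) and
-- {1} ∪ (A+2) for A ∈ F; conversely ↓G = {A : {0} ∪ (A+2), {1} ∪ (A+2) ∈ G}.
-- Both constructions preserve being left-compressed and intersecting.  If F is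
-- an MLCIF, extend ↑F to an MLCIF G on [n+2]: then F ⊆ ↓G, and maximality of F
-- forces ↓G = F.  Hence ↓ maps the MLCIFs on [n+2] onto those on [n], and
-- n = 2k gives the claim.
module Submission where

-- Defs._∈_ is setoid membership for _≡_, definitionally the propositional one.
open import Defs hiding (_∈_)
open import Data.Nat using (ℕ; suc; _+_; _≟_; _*_; _≤_; _<_; z≤n; s≤s; s≤s⁻¹; z<s)
import Data.Nat.Properties as ℕ
open import Data.Nat.Induction using (<-wellFounded)
open import Induction.WellFounded using (Acc; acc)
open import Data.Unit using (⊤; tt)
open import Data.Empty using (⊥; ⊥-elim)
open import Data.Sum using (_⊎_; inj₁; inj₂)
open import Data.Product using (_×_; _,_; proj₁; proj₂; ∃)
open import Data.List using (List; []; _∷_; map; _++_; filter; length)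
open import Data.List.Properties using (length-map; length-++-sucʳ; ∷-injectiveʳ)
open import Data.List.Relation.Unary.Any using (here; there; any?)
open import Data.List.Relation.Unary.All as All using (All; [])
open import Data.List.Relation.Unary.All.Properties.Core using (¬All⇒Any¬)
open import Data.List.Relation.Unary.AllPairs using ([]; _∷_)
open import Data.List.Relation.Unary.Unique.Propositional using (Unique)
import Data.List.Relation.Unary.Unique.Propositional.Properties as Unique
open import Data.List.Relation.Binary.Pointwise as Pointwise using (Pointwise; _∷_)
open import Data.List.Relation.Binary.Subset.Propositional using (_⊆_)
open import Data.List.Membership.Propositional using (_∈_; _∉_; find; lose)
open import Data.List.Membership.Propositional.Properties
  using (∈-++⁺ˡ; ∈-++⁺ʳ; ∈-++⁻; ∈-map⁺; ∈-map⁻; ∈-∃++; ∈-filter⁺; ∈-filter⁻)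
open import Data.Vec using ([]; _∷_; here; there)
import Data.Vec.Properties as Vec
open import Data.Fin using (zero; suc)
open import Data.Fin.Subset using (Subset; inside; outside; _∩_; Nonempty; ∣_∣)
open import Function using (_∘_)
open import Relation.Nullary using (Dec; yes; no; ¬_; ¬?)
open import Relation.Nullary.Decidable using (_×-dec_; decidable-stable)
open import Relation.Unary using (Decidable)
open import Relation.Binary.PropositionalEquality using (_≡_; _≢_; refl; sym; trans; cong; subst)

module _ {A : Set} where

  ∈-++-∷⁻ : ∀ {x y : A} as bs → y ∈ as ++ x ∷ bs → y ≢ x → y ∈ as ++ bs
  ∈-++-∷⁻ as bs y∈ y≢x with ∈-++⁻ as y∈
  ... | inj₁ y∈as         = ∈-++⁺ˡ y∈as
  ... | inj₂ (here y≡x)   = ⊥-elim (y≢x y≡x)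
  ... | inj₂ (there y∈bs) = ∈-++⁺ʳ as y∈bs

  unique-⊆⇒length-≤ : {xs zs : List A} → Unique xs → xs ⊆ zs → length xs ≤ length zs
  unique-⊆⇒length-≤ {[]}     _            _     = z≤n
  unique-⊆⇒length-≤ {x ∷ xs} (x∉xs ∷ u) xs⊆zs
    with as , bs , refl ← ∈-∃++ (xs⊆zs (here refl)) =
    subst (suc (length xs) ≤_) (sym (length-++-sucʳ as x bs))
      (s≤s (unique-⊆⇒length-≤ u λ y∈xs →
        ∈-++-∷⁻ as bs (xs⊆zs (there y∈xs)) (All.lookup x∉xs y∈xs ∘ sym)))

  module _ {P Q : A → Set} (P? : Decidable P) (Q? : Decidable Q)
           (P⇒Q : ∀ {x} → P x → Q x) where

    length-filter-mono-≤ : ∀ xs → length (filter P? xs) ≤ length (filter Q? xs)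
    length-filter-mono-≤ []       = z≤n
    length-filter-mono-≤ (x ∷ xs) with P? x | Q? x
    ... | yes _  | yes _  = s≤s (length-filter-mono-≤ xs)
    ... | yes Px | no ¬Qx = ⊥-elim (¬Qx (P⇒Q Px))
    ... | no _   | yes _  = ℕ.m≤n⇒m≤1+n (length-filter-mono-≤ xs)
    ... | no _   | no _   = length-filter-mono-≤ xs

    length-filter-mono-< : ∀ {x xs} → x ∈ xs → Q x → ¬ P x →
                           length (filter P? xs) < length (filter Q? xs)
    length-filter-mono-< {xs = y ∷ xs} (here refl) Qx ¬Px with P? y | Q? y
    ... | yes Px | _      = ⊥-elim (¬Px Px)
    ... | no _   | yes _  = s≤s (length-filter-mono-≤ xs)
    ... | no _   | no ¬Qx = ⊥-elim (¬Qx Qx)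
    length-filter-mono-< {xs = y ∷ xs} (there x∈xs) Qx ¬Px with P? y | Q? y
    ... | yes _  | yes _  = s≤s (length-filter-mono-< x∈xs Qx ¬Px)
    ... | yes Py | no ¬Qy = ⊥-elim (¬Qy (P⇒Q Py))
    ... | no _   | yes _  = ℕ.m≤n⇒m≤1+n (length-filter-mono-< x∈xs Qx ¬Px)
    ... | no _   | no _   = length-filter-mono-< x∈xs Qx ¬Px

  ∈-sublists-∷⁻ : ∀ (x : A) xs {L} → L ∈ sublists (x ∷ xs) →
                  L ∈ sublists xs ⊎ ∃ λ L′ → L′ ∈ sublists xs × L ≡ x ∷ L′
  ∈-sublists-∷⁻ x xs L∈ with ∈-++⁻ (sublists xs) L∈
  ... | inj₁ L∈xs  = inj₁ L∈xs
  ... | inj₂ L∈x∷ = inj₂ (∈-map⁻ (x ∷_) L∈x∷)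

  sublists-⊆ : ∀ {xs L} → L ∈ sublists xs → L ⊆ xs
  sublists-⊆ {[]}    (here refl) ()
  sublists-⊆ {x ∷ xs} L∈ y∈L with ∈-sublists-∷⁻ x xs L∈
  ... | inj₁ L∈xs = there (sublists-⊆ L∈xs y∈L)
  ... | inj₂ (L′ , L′∈xs , refl) with y∈L
  ...   | here y≡x    = here y≡x
  ...   | there y∈L′ = there (sublists-⊆ L′∈xs y∈L′)

  filter∈sublists : ∀ {P : A → Set} (P? : Decidable P) xs → filter P? xs ∈ sublists xs
  filter∈sublists P? []       = here refl
  filter∈sublists P? (x ∷ xs) with P? x
  ... | yes _ = ∈-++⁺ʳ (sublists xs) (∈-map⁺ (x ∷_) (filter∈sublists P? xs))
  ... | no _  = ∈-++⁺ˡ (filter∈sublists P? xs)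

  ∉-sublists : ∀ {x xs L} → All (x ≢_) xs → L ∈ sublists xs → x ∉ L
  ∉-sublists x∉xs L∈ x∈L = All.lookup x∉xs (sublists-⊆ L∈ x∈L) refl

  ∷-⊆-cancel : ∀ {x : A} {L L′} → x ∉ L → x ∷ L ⊆ x ∷ L′ → L ⊆ L′
  ∷-⊆-cancel x∉L sub y∈L with sub (there y∈L)
  ... | here refl    = ⊥-elim (x∉L y∈L)
  ... | there y∈L′ = y∈L′

  sublists-unique : ∀ {xs} → Unique xs → Unique (sublists xs)
  sublists-unique {[]}     _            = [] ∷ []
  sublists-unique {x ∷ xs} (x∉xs ∷ u) =
    Unique.++⁺ (sublists-unique u) (Unique.map⁺ ∷-injectiveʳ (sublists-unique u)) disjoint
    where
    disjoint : ∀ {L} → ¬ (L ∈ sublists xs × L ∈ map (x ∷_) (sublists xs))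
    disjoint (L∈xs , L∈x∷) with _ , _ , refl ← ∈-map⁻ (x ∷_) L∈x∷ =
      ∉-sublists x∉xs L∈xs (here refl)

  sublists-ext : ∀ {xs L₁ L₂} → Unique xs → L₁ ∈ sublists xs → L₂ ∈ sublists xs →
                 L₁ ⊆ L₂ → L₂ ⊆ L₁ → L₁ ≡ L₂
  sublists-ext {[]} _ (here refl) (here refl) _ _ = refl
  sublists-ext {x ∷ xs} (x∉xs ∷ u) L₁∈ L₂∈ L₁⊆L₂ L₂⊆L₁
    with ∈-sublists-∷⁻ x xs L₁∈ | ∈-sublists-∷⁻ x xs L₂∈
  ... | inj₁ L₁∈xs | inj₁ L₂∈xs = sublists-ext u L₁∈xs L₂∈xs L₁⊆L₂ L₂⊆L₁
  ... | inj₁ L₁∈xs | inj₂ (_ , _ , refl) = ⊥-elim (∉-sublists x∉xs L₁∈xs (L₂⊆L₁ (here refl)))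
  ... | inj₂ (_ , _ , refl) | inj₁ L₂∈xs = ⊥-elim (∉-sublists x∉xs L₂∈xs (L₁⊆L₂ (here refl)))
  ... | inj₂ (_ , L₁′∈ , refl) | inj₂ (_ , L₂′∈ , refl) =
    cong (x ∷_) (sublists-ext u L₁′∈ L₂′∈
      (∷-⊆-cancel (∉-sublists x∉xs L₁′∈) L₁⊆L₂)
      (∷-⊆-cancel (∉-sublists x∉xs L₂′∈) L₂⊆L₁))

module _ {A : Set} {P : A → Set} {_⊑_ : A → A → Set}
         (P? : Decidable P) (_⊑?_ : ∀ x y → Dec (x ⊑ y))
         (⊑-refl : ∀ {x} → x ⊑ x) (⊑-trans : ∀ {x y z} → x ⊑ y → y ⊑ z → x ⊑ z)
         (xs : List A) (μ : A → ℕ)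
         (μ-strict : ∀ {x y} → y ∈ xs → x ⊑ y → ¬ y ⊑ x → μ y < μ x) where

  Maximal : A → Set
  Maximal x = All (λ y → P y → x ⊑ y → y ⊑ x) xs

  maximal-above : ∀ {x} → x ∈ xs → P x → ∃ λ y → y ∈ xs × P y × Maximal y × x ⊑ y
  maximal-above x∈xs Px = go x∈xs Px (<-wellFounded _)
    where
    go : ∀ {x} → x ∈ xs → P x → Acc _<_ (μ x) → ∃ λ y → y ∈ xs × P y × Maximal y × x ⊑ y
    go {x} x∈xs Px (acc rs) with any? (λ y → P? y ×-dec (x ⊑? y) ×-dec ¬? (y ⊑? x)) xs
    ... | yes above
      with y , y∈xs , Py , x⊑y , y⋢x ← find above
      with z , z∈xs , Pz , z-max , y⊑z ← go y∈xs Py (rs (μ-strict y∈xs x⊑y y⋢x)) =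
      z , z∈xs , Pz , z-max , ⊑-trans x⊑y y⊑z
    ... | no ¬above = x , x∈xs , Px , All.tabulate x-max , ⊑-refl
      where
      x-max : ∀ {y} → y ∈ xs → P y → x ⊑ y → y ⊑ x
      x-max {y} y∈xs Py x⊑y =
        decidable-stable (y ⊑? x) λ y⋢x → ¬above (lose y∈xs (Py , x⊑y , y⋢x))

∈-allSubsets : ∀ {n} (s : Subset n) → s ∈ allSubsets n
∈-allSubsets []            = here refl
∈-allSubsets (outside ∷ s) = ∈-++⁺ˡ (∈-map⁺ (outside ∷_) (∈-allSubsets s))
∈-allSubsets (inside ∷ s)  =
  ∈-++⁺ʳ (map (outside ∷_) (allSubsets _)) (∈-map⁺ (inside ∷_) (∈-allSubsets s))

allSubsets-unique : ∀ n → Unique (allSubsets n)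
allSubsets-unique 0       = [] ∷ []
allSubsets-unique (suc n) =
  Unique.++⁺ (Unique.map⁺ Vec.∷-injectiveʳ (allSubsets-unique n))
             (Unique.map⁺ Vec.∷-injectiveʳ (allSubsets-unique n)) disjoint
  where
  disjoint : ∀ {s} → ¬ (s ∈ map (outside ∷_) (allSubsets n) × s ∈ map (inside ∷_) (allSubsets n))
  disjoint (s∈₀ , s∈₁) with _ , _ , refl ← ∈-map⁻ (outside ∷_) s∈₀
                        with _ , _ , () ← ∈-map⁻ (inside ∷_) s∈₁

module _ {n k : ℕ} where

  ∈-ksets⁺ : {s : Subset n} → ∣ s ∣ ≡ k → s ∈ ksets n k
  ∈-ksets⁺ = ∈-filter⁺ (λ s → ∣ s ∣ ≟ k) (∈-allSubsets _)

  ∈-ksets⁻ : {s : Subset n} → s ∈ ksets n k → ∣ s ∣ ≡ k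
  ∈-ksets⁻ = proj₂ ∘ ∈-filter⁻ (λ s → ∣ s ∣ ≟ k) {xs = allSubsets n}

  ksets-unique : Unique (ksets n k)
  ksets-unique = Unique.filter⁺ (λ s → ∣ s ∣ ≟ k) (allSubsets-unique n)

  families-unique : Unique (families n k)
  families-unique = sublists-unique ksets-unique

module _ {n : ℕ} where

  ⊆F-refl : {F : Family n} → F ⊆F F
  ⊆F-refl = All.tabulate (λ s∈F → s∈F)

  ⊆F-trans : {F G H : Family n} → F ⊆F G → G ⊆F H → F ⊆F H
  ⊆F-trans F⊆G G⊆H = All.map (All.lookup G⊆H) F⊆G

  uncovered : List (Subset n) → Family n → ℕ
  uncovered U F = length (filter (λ s → ¬? (s ∈? F)) U)

  uncovered-< : ∀ {U F G} → G ⊆ U → F ⊆F G → ¬ G ⊆F F → uncovered U G < uncovered U F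
  uncovered-< {U} {F} {G} G⊆U F⊆G G⊈F
    with s , s∈G , s∉F ← find (¬All⇒Any¬ (_∈? F) G G⊈F) =
    length-filter-mono-< (λ s → ¬? (s ∈? G)) (λ s → ¬? (s ∈? F))
      (λ s∉G s∈F → s∉G (All.lookup F⊆G s∈F)) (G⊆U s∈G) s∉F (λ s∉G → s∉G s∈G)

extend-to-MLCIF : ∀ {n k G} → G ∈ families n k → LCI n k G → ∃ λ G* → G* ∈ 𝓜 n k × G ⊆F G*
extend-to-MLCIF {n} {k} G∈ G-lci
  with G* , G*∈ , G*-lci , G*-max , G⊆G* ←
         maximal-above (LCI? n k) _⊆F?_ ⊆F-refl ⊆F-trans (families n k) (uncovered (ksets n k))
                       (λ G∈ → uncovered-< {U = ksets n k} (sublists-⊆ G∈)) G∈ G-lci =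
  G* , ∈-filter⁺ (MLCIF? n k) G*∈ (G*-lci , G*-max) , G⊆G*

∈-𝓜⁻ : ∀ {n k F} → F ∈ 𝓜 n k → F ∈ families n k × MLCIF n k F
∈-𝓜⁻ {n} {k} = ∈-filter⁻ (MLCIF? n k) {xs = families n k}

module _ {n : ℕ} {F : Family n} where

  intersecting⁺ : (∀ {A B} → A ∈ F → B ∈ F → Nonempty (A ∩ B)) → Intersecting F
  intersecting⁺ ∩≢∅ = All.tabulate λ A∈F → All.tabulate λ B∈F → ∩≢∅ A∈F B∈F

  intersecting⁻ : Intersecting F → ∀ {A B} → A ∈ F → B ∈ F → Nonempty (A ∩ B)
  intersecting⁻ F-int A∈F B∈F = All.lookup (All.lookup F-int A∈F) B∈F

  module _ {k : ℕ} where

    leftCompressed⁺ : (∀ {A C} → A ∈ F → C ∈ ksets n k → C ≤LC A → C ∈ F) → LeftCompressed n k F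
    leftCompressed⁺ closed = All.tabulate λ A∈F → All.tabulate λ C∈ → closed A∈F C∈

    leftCompressed⁻ : LeftCompressed n k F → ∀ {A C} → A ∈ F → C ∈ ksets n k → C ≤LC A → C ∈ F
    leftCompressed⁻ F-lc A∈F C∈ = All.lookup (All.lookup F-lc A∈F) C∈

filter-ksets-LCI : ∀ {n k} {P : Subset n → Set} (P? : Decidable P) →
                   (∀ {A B} → P A → P B → Nonempty (A ∩ B)) →
                   (∀ {A C} → P A → C ∈ ksets n k → C ≤LC A → P C) →
                   LCI n k (filter P? (ksets n k))
filter-ksets-LCI {n} {k} {P} P? ∩≢∅ closed =
    intersecting⁺ (λ A∈ B∈ → ∩≢∅ (satisfies A∈) (satisfies B∈))
  , leftCompressed⁺ (λ A∈ C∈ C≤A → ∈-filter⁺ P? C∈ (closed (satisfies A∈) C∈ C≤A))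
  where
  satisfies : ∀ {A} → A ∈ filter P? (ksets n k) → P A
  satisfies = proj₂ ∘ ∈-filter⁻ P? {xs = ksets n k}

∈-ksets-suc⁺ : ∀ {m n k} {A : Subset n} {B : Subset m} →
               ∣ B ∣ ≡ suc ∣ A ∣ → A ∈ ksets n k → B ∈ ksets m (suc k)
∈-ksets-suc⁺ ∣B∣≡ A∈ = ∈-ksets⁺ (trans ∣B∣≡ (cong suc (∈-ksets⁻ A∈)))

∈-ksets-suc⁻ : ∀ {m n k} {A : Subset n} {B : Subset m} →
               ∣ B ∣ ≡ suc ∣ A ∣ → B ∈ ksets m (suc k) → A ∈ ksets n k
∈-ksets-suc⁻ ∣B∣≡ B∈ = ∈-ksets⁺ (ℕ.suc-injective (trans (sym ∣B∣≡) (∈-ksets⁻ B∈)))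

shift₂ : List ℕ → List ℕ
shift₂ = map suc ∘ map suc

shift₂⁺ : ∀ {xs ys} → Pointwise _≤_ xs ys → Pointwise _≤_ (shift₂ xs) (shift₂ ys)
shift₂⁺ = Pointwise.map⁺ suc suc ∘ Pointwise.map s≤s ∘ Pointwise.map⁺ suc suc ∘ Pointwise.map s≤s

shift₂⁻ : ∀ {xs ys} → Pointwise _≤_ (shift₂ xs) (shift₂ ys) → Pointwise _≤_ xs ys
shift₂⁻ = Pointwise.map s≤s⁻¹ ∘ Pointwise.map⁻ suc suc ∘ Pointwise.map s≤s⁻¹ ∘ Pointwise.map⁻ suc suc

shift₂-≰ : ∀ xs {m ys} → m < 2 → ¬ Pointwise _≤_ (shift₂ xs) (m ∷ ys)
shift₂-≰ []      _   ()
shift₂-≰ (_ ∷ _) m<2 (2+x≤m ∷ _) = ℕ.<⇒≱ m<2 (ℕ.≤-trans (s≤s (s≤s z≤n)) 2+x≤m)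

ins₀ ins₁ : ∀ {n} → Subset n → Subset (2 + n)
ins₀ A = inside  ∷ outside ∷ A
ins₁ A = outside ∷ inside  ∷ A

nonempty-∷⁺ : ∀ {n a} {s : Subset n} → Nonempty s → Nonempty (a ∷ s)
nonempty-∷⁺ (i , i∈) = suc i , there i∈

∩-ins⁻ : ∀ {n} {A B : Subset n} → Nonempty (ins₀ A ∩ ins₁ B) → Nonempty (A ∩ B)
∩-ins⁻ (suc (suc i) , there (there i∈)) = i , i∈

module Lifting (n k : ℕ) where

  _∈↑_ : Subset (2 + n) → Family n → Set
  (inside  ∷ inside  ∷ _) ∈↑ F = ⊤
  (inside  ∷ outside ∷ A) ∈↑ F = A ∈ F
  (outside ∷ inside  ∷ A) ∈↑ F = A ∈ F
  (outside ∷ outside ∷ _) ∈↑ F = ⊥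

  _∈↑?_ : ∀ B F → Dec (B ∈↑ F)
  (inside  ∷ inside  ∷ _) ∈↑? F = yes tt
  (inside  ∷ outside ∷ A) ∈↑? F = A ∈? F
  (outside ∷ inside  ∷ A) ∈↑? F = A ∈? F
  (outside ∷ outside ∷ _) ∈↑? F = no λ ()

  _∈↓_ : Subset n → Family (2 + n) → Set
  A ∈↓ G = ins₀ A ∈ G × ins₁ A ∈ G

  _∈↓?_ : ∀ A G → Dec (A ∈↓ G)
  A ∈↓? G = ins₀ A ∈? G ×-dec ins₁ A ∈? G

  lift : Family n → Family (2 + n)
  lift F = filter (_∈↑? F) (ksets (2 + n) (suc k))

  lower : Family (2 + n) → Family n
  lower G = filter (_∈↓? G) (ksets n k)

  ∈↑-intersecting : ∀ {F} → Intersecting F → ∀ {B C} → B ∈↑ F → C ∈↑ F → Nonempty (B ∩ C)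
  ∈↑-intersecting _ {inside ∷ _ ∷ _} {inside ∷ _ ∷ _} _ _ = zero , here
  ∈↑-intersecting _ {_ ∷ inside ∷ _} {_ ∷ inside ∷ _} _ _ = suc zero , there here
  ∈↑-intersecting F-int {inside ∷ outside ∷ _} {outside ∷ inside ∷ _} A∈F B∈F =
    nonempty-∷⁺ (nonempty-∷⁺ (intersecting⁻ F-int A∈F B∈F))
  ∈↑-intersecting F-int {outside ∷ inside ∷ _} {inside ∷ outside ∷ _} A∈F B∈F =
    nonempty-∷⁺ (nonempty-∷⁺ (intersecting⁻ F-int A∈F B∈F))
  ∈↑-intersecting _ {outside ∷ outside ∷ _} ()
  ∈↑-intersecting _ {_} {outside ∷ outside ∷ _} _ ()

  -- The i-th element of C is at most that of B, so C meets {0, 1} at least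
  -- as much as B does, and when both meet it in one point, C - 2 ≤LC B - 2.
  ∈↑-leftCompressed : ∀ {F} → LeftCompressed n k F →
                      ∀ {B C} → B ∈↑ F → C ∈ ksets (2 + n) (suc k) → C ≤LC B → C ∈↑ F
  ∈↑-leftCompressed _ {C = inside ∷ inside ∷ _} _ _ _ = tt
  ∈↑-leftCompressed _ {inside ∷ inside ∷ _} {inside ∷ outside ∷ C} _ _ (_ ∷ C≤B) =
    ⊥-elim (shift₂-≰ (elems C) (ℕ.n<1+n 1) C≤B)
  ∈↑-leftCompressed F-lc {inside ∷ outside ∷ _} {inside ∷ outside ∷ _} A∈F C∈ (_ ∷ C≤B) =
    leftCompressed⁻ F-lc A∈F (∈-ksets-suc⁻ refl C∈) (shift₂⁻ C≤B)
  ∈↑-leftCompressed F-lc {outside ∷ inside ∷ _} {inside ∷ outside ∷ _} A∈F C∈ (_ ∷ C≤B) =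
    leftCompressed⁻ F-lc A∈F (∈-ksets-suc⁻ refl C∈) (shift₂⁻ C≤B)
  ∈↑-leftCompressed F-lc {outside ∷ inside ∷ _} {outside ∷ inside ∷ _} A∈F C∈ (_ ∷ C≤B) =
    leftCompressed⁻ F-lc A∈F (∈-ksets-suc⁻ refl C∈) (shift₂⁻ C≤B)
  ∈↑-leftCompressed _ {inside ∷ _ ∷ _} {outside ∷ inside ∷ _} _ _ (() ∷ _)
  ∈↑-leftCompressed _ {inside ∷ _ ∷ _} {outside ∷ outside ∷ C} _ _ C≤B =
    ⊥-elim (shift₂-≰ (elems C) z<s C≤B)
  ∈↑-leftCompressed _ {outside ∷ inside ∷ _} {outside ∷ outside ∷ C} _ _ C≤B =
    ⊥-elim (shift₂-≰ (elems C) (ℕ.n<1+n 1) C≤B)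
  ∈↑-leftCompressed _ {outside ∷ outside ∷ _} ()

  ∈↓-intersecting : ∀ {G} → Intersecting G → ∀ {A B} → A ∈↓ G → B ∈↓ G → Nonempty (A ∩ B)
  ∈↓-intersecting G-int (A₀∈G , _) (_ , B₁∈G) = ∩-ins⁻ (intersecting⁻ G-int A₀∈G B₁∈G)

  ∈↓-leftCompressed : ∀ {G} → LeftCompressed (2 + n) (suc k) G →
                      ∀ {A C} → A ∈↓ G → C ∈ ksets n k → C ≤LC A → C ∈↓ G
  ∈↓-leftCompressed G-lc (A₀∈G , A₁∈G) C∈ C≤A =
      leftCompressed⁻ G-lc A₀∈G (∈-ksets-suc⁺ refl C∈) (z≤n ∷ shift₂⁺ C≤A)
    , leftCompressed⁻ G-lc A₁∈G (∈-ksets-suc⁺ refl C∈) (s≤s z≤n ∷ shift₂⁺ C≤A)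

  lift-LCI : ∀ {F} → LCI n k F → LCI (2 + n) (suc k) (lift F)
  lift-LCI (F-int , F-lc) =
    filter-ksets-LCI (_∈↑? _) (∈↑-intersecting F-int) (∈↑-leftCompressed F-lc)

  lower-LCI : ∀ {G} → LCI (2 + n) (suc k) G → LCI n k (lower G)
  lower-LCI (G-int , G-lc) =
    filter-ksets-LCI _ (∈↓-intersecting G-int) (∈↓-leftCompressed G-lc)

  lift-⊆⇒⊆-lower : ∀ {F G} → F ∈ families n k → lift F ⊆F G → F ⊆F lower G
  lift-⊆⇒⊆-lower {F} {G} F∈ liftF⊆G = All.tabulate λ A∈F →
    let A∈ = sublists-⊆ F∈ A∈F in
    ∈-filter⁺ _ A∈ (lifted A∈F (∈-ksets-suc⁺ refl A∈) , lifted A∈F (∈-ksets-suc⁺ refl A∈))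
    where
    lifted : ∀ {B} → B ∈↑ F → B ∈ ksets (2 + n) (suc k) → B ∈ G
    lifted B∈↑F B∈ = All.lookup liftF⊆G (∈-filter⁺ (_∈↑? F) B∈ B∈↑F)

  lower-lift : ∀ {F G} → F ∈ families n k → MLCIF n k F →
               LCI (2 + n) (suc k) G → lift F ⊆F G → lower G ≡ F
  lower-lift {F} {G} F∈ (_ , F-max) G-lci liftF⊆G =
    sublists-ext ksets-unique lower∈ F∈ (All.lookup lower⊆F) (All.lookup F⊆lower)
    where
    lower∈ : lower G ∈ families n k
    lower∈ = filter∈sublists _ (ksets n k)

    F⊆lower : F ⊆F lower G
    F⊆lower = lift-⊆⇒⊆-lower F∈ liftF⊆G

    lower⊆F : lower G ⊆F F
    lower⊆F = All.lookup F-max lower∈ (lower-LCI G-lci) F⊆lower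

  𝓜⊆lower-𝓜 : 𝓜 n k ⊆ map lower (𝓜 (2 + n) (suc k))
  𝓜⊆lower-𝓜 F∈𝓜
    with F∈ , F-mlcif ← ∈-𝓜⁻ F∈𝓜
    with G , G∈𝓜 , liftF⊆G ←
           extend-to-MLCIF (filter∈sublists (_∈↑? _) (ksets (2 + n) (suc k))) (lift-LCI (proj₁ F-mlcif)) =
    subst (_∈ map lower _) (lower-lift F∈ F-mlcif (proj₁ (proj₂ (∈-𝓜⁻ G∈𝓜))) liftF⊆G)
      (∈-map⁺ lower G∈𝓜)

#MLCIF-mono : ∀ n k → #MLCIF n k ≤ #MLCIF (2 + n) (suc k)
#MLCIF-mono n k = subst (#MLCIF n k ≤_) (length-map lower (𝓜 (2 + n) (suc k)))
  (unique-⊆⇒length-≤ (Unique.filter⁺ (MLCIF? n k) families-unique) 𝓜⊆lower-𝓜)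
  where open Lifting n k

lemma4p1 : (k : ℕ) → #MLCIF (2 * k) k ≤ #MLCIF (2 * suc k) (suc k)
lemma4p1 k = subst (λ m → #MLCIF (2 * k) k ≤ #MLCIF m (suc k)) (sym (ℕ.*-suc 2 k))
  (#MLCIF-mono (2 * k) k)
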